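{- In the 2-balanced setting described in the context (with the directions of all adjacencies of $\pi$ fixed as described, and with the first adjacency $\langle r(x_0),l(x_1)\rangle$ and last adjacency $\langle r(x_n),l(x_{n+1})\rangle$ of $\pi$ positive), $\pi=\tau$ if and only if $N_{MNS}[\pi]=0$.
   Context: Fix genes $\Sigma_1$ and repeats $\Sigma_2\ni r_0$. A chromosome is a sequence $\pi=[x_0,\dots,x_{n+1}]$ of signed symbols ($x_i=\pm a$, $|x_i|=a$) with $x_0=+r_0$, $x_{n+1}=-r_0$, every gene occurring exactly once. Each occurrence $x_i$ has nodes $l(x_i),r(x_i)$: $(a^h,a^t)$ if $x_i=+a$, $(a^t,a^h)$ if $x_i=-a$. Adjacencies of $\pi$: the unordered pairs $\langle r(x_i),l(x_{i+1})\rangle$, $0\le i\le n$; $\mathcal{A}[\pi]$ is their multiset; $\pi$ is simple if no adjacency occurs twice. 2-balanced setting: $\pi=[x_0,\dots,x_{n+1}]$ and $\tau=[y_0,\dots,y_{n+1}]$ are simple related chromosomes (same duplication numbers for every symbol) with $\mathcal{A}[\pi]=\mathcal{A}[\tau]$, every repeat occurring exactly twice in each, and for every repeat $r$, $\tau$ contains both $+r$ and $-r$. Identical adjacencies are matched by the unique bijection. If $\langle r(x_i),l(x_{i+1})\rangle$ is matched to $\langle r(y_j),l(y_{j+1})\rangle$, it is positive if $r(x_i)=r(y_j)\ne l(x_{i+1})=l(y_{j+1})$, negative if $r(x_i)=l(y_{j+1})\ne l(x_{i+1})=r(y_j)$, and entangled if $r(x_i)=l(x_{i+1})=r(y_j)=l(y_{j+1})$;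 each entangled adjacency is given the same direction as its two neighbouring adjacencies. A maximal positive (negative) segment, MPS (MNS), is a maximal run of consecutive adjacencies of $\pi$ all positive (negative); $N_{MNS}[\pi]$ is the number of MNS of $\pi$. -}

module Defs where

open import Data.Nat using (ℕ; zero; suc; _+_)
open import Data.Fin using (Fin; zero; suc; toℕ; inject₁; fromℕ)
open import Data.Vec using (Vec; lookup; head; last; tabulate; toList; _∷_; [])
open import Data.Sum using (_⊎_; inj₁; inj₂)
open import Data.Sum.Properties using (≡-dec)
open import Data.Product using (_×_; _,_; Σ; ∃; ∃-syntax)
open import Data.List using (List; []; _∷_)
open import Relation.Binary.PropositionalEquality
open import Relation.Binary.Definitions using (DecidableEquality)
open import Relation.Binary.Structures using (IsEquivalence)
open import Relation.Binary.Bundles using (Setoid)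
open import Relation.Nullary using (¬_; yes; no)
import Data.List.Relation.Binary.Permutation.Setoid as PermS
import Data.List.Relation.Unary.Unique.Setoid as UniqS

-- Symbols: genes G (Σ₁) and repeats R (Σ₂); a symbol is an element of G ⊎ R.

Sym : Set → Set → Set
Sym G R = G ⊎ R

data Sign : Set where
  plus minus : Sign

SSym : Set → Set → Set
SSym G R = Sign × Sym G R

data End : Set where
  hd tl : End

Node : Set → Set → Set
Node G R = Sym G R × End

lnode : ∀ {G R} → SSym G R → Node G R
lnode (plus , a) = (a , hd)
lnode (minus , a) = (a , tl)

rnode : ∀ {G R} → SSym G R → Node G R
rnode (plus , a) = (a , tl)
rnode (minus , a) = (a , hd)

-- Adjacencies: unordered pairs of nodes, represented as ordered pairs
-- compared up to swapping.

Adj : Set → Set → Set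
Adj G R = Node G R × Node G R

_≈A_ : ∀ {G R} → Adj G R → Adj G R → Set
(u , v) ≈A (u' , v') = (u ≡ u' × v ≡ v') ⊎ (u ≡ v' × v ≡ u')

≈A-isEquivalence : ∀ {G R} → IsEquivalence (_≈A_ {G} {R})
≈A-isEquivalence = record
  { refl  = inj₁ (refl , refl)
  ; sym   = λ { (inj₁ (p , q)) → inj₁ (sym p , sym q)
              ; (inj₂ (p , q)) → inj₂ (sym q , sym p) }
  ; trans = λ { (inj₁ (p , q)) (inj₁ (p' , q')) → inj₁ (trans p p' , trans q q')
              ; (inj₁ (p , q)) (inj₂ (p' , q')) → inj₂ (trans p p' , trans q q')
              ; (inj₂ (p , q)) (inj₁ (p' , q')) → inj₂ (trans p q' , trans q p')
              ; (inj₂ (p , q)) (inj₂ (p' , q')) → inj₁ (trans p q' , trans q p') }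
  }

AdjSetoid : Set → Set → Setoid _ _
AdjSetoid G R = record { Carrier = Adj G R ; _≈_ = _≈A_ ; isEquivalence = ≈A-isEquivalence }

-- A chromosome [x_0, …, x_{n+1}] is a vector of length n+2.
-- Adjacency i (0 ≤ i ≤ n) is ⟨ r(x_i) , l(x_{i+1}) ⟩.

module _ {G R : Set} {n : ℕ} where

  rA : Vec (SSym G R) (suc (suc n)) → Fin (suc n) → Node G R
  rA π i = rnode (lookup π (inject₁ i))

  lA : Vec (SSym G R) (suc (suc n)) → Fin (suc n) → Node G R
  lA π i = lnode (lookup π (suc i))

  adj : Vec (SSym G R) (suc (suc n)) → Fin (suc n) → Adj G R
  adj π i = (rA π i , lA π i)

  -- the multiset 𝒜[π], as a list
  adjList : Vec (SSym G R) (suc (suc n)) → List (Adj G R)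
  adjList π = toList (tabulate (adj π))

occ : ∀ {S : Set} {m} → DecidableEquality S → S → Vec (Sign × S) m → ℕ
occ _≟_ a [] = 0
occ _≟_ a ((_ , b) ∷ xs) with a ≟ b
... | yes _ = suc (occ _≟_ a xs)
... | no  _ = occ _≟_ a xs

module Setting {G R : Set} (_≟G_ : DecidableEquality G) (_≟R_ : DecidableEquality R)
               (r₀ : R) {n : ℕ} where

  _≟S_ : DecidableEquality (Sym G R)
  _≟S_ = ≡-dec _≟G_ _≟R_

  Chr : Set
  Chr = Vec (SSym G R) (suc (suc n))

  IsChromosome : Chr → Set
  IsChromosome π = head π ≡ (plus , inj₂ r₀)
                 × last π ≡ (minus , inj₂ r₀)
                 × (∀ (g : G) → occ _≟S_ (inj₁ g) π ≡ 1)

  Simple : Chr → Set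
  Simple π = UniqS.Unique (AdjSetoid G R) (adjList π)

  Related : Chr → Chr → Set
  Related π τ = ∀ (a : Sym G R) → occ _≟S_ a π ≡ occ _≟S_ a τ

  SameAdjacencies : Chr → Chr → Set
  SameAdjacencies π τ = PermS._↭_ (AdjSetoid G R) (adjList π) (adjList τ)

  TwoBalanced : Chr → Chr → Set
  TwoBalanced π τ =
      IsChromosome π × IsChromosome τ
    × Simple π × Simple τ
    × Related π τ
    × SameAdjacencies π τ
    × (∀ (r : R) → occ _≟S_ (inj₂ r) π ≡ 2)
    × (∀ (r : R) → occ _≟S_ (inj₂ r) τ ≡ 2)
    × (∀ (r : R) → (∃[ j ] lookup τ j ≡ (plus , inj₂ r))
                 × (∃[ j ] lookup τ j ≡ (minus , inj₂ r)))

  -- Adjacency i of π matched to adjacency j of τ and positive / negative / entangled.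
  -- (Each of these conditions forces adj π i ≈A adj τ j, i.e. j is the matched
  -- adjacency; by simplicity of τ it is unique.)
  Positive : Chr → Chr → Fin (suc n) → Set
  Positive π τ i = ∃[ j ] (rA π i ≡ rA τ j × lA π i ≡ lA τ j × rA π i ≢ lA π i)

  Negative : Chr → Chr → Fin (suc n) → Set
  Negative π τ i = ∃[ j ] (rA π i ≡ lA τ j × lA π i ≡ rA τ j × rA π i ≢ lA π i)

  Entangled : Chr → Chr → Fin (suc n) → Set
  Entangled π τ i = ∃[ j ] (rA π i ≡ lA π i × rA π i ≡ rA τ j × rA π i ≡ lA τ j)

data Dir : Set where
  pos neg : Dir

Neighbour : ∀ {m} → Fin m → Fin m → Set
Neighbour k i = toℕ k ≡ suc (toℕ i) ⊎ suc (toℕ k) ≡ toℕ i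

module _ {G R : Set} (_≟G_ : DecidableEquality G) (_≟R_ : DecidableEquality R)
         (r₀ : R) {n : ℕ} where
  open Setting _≟G_ _≟R_ r₀ {n}

  ValidDirections : Chr → Chr → (Fin (suc n) → Dir) → Set
  ValidDirections π τ dir = ∀ i →
      (Positive π τ i → dir i ≡ pos)
    × (Negative π τ i → dir i ≡ neg)
    × (Entangled π τ i → ∀ k → Neighbour k i → dir k ≡ dir i)

nRuns : Dir → List Dir → ℕ
nRuns _   [] = 0
nRuns pos (neg ∷ ds) = suc (nRuns neg ds)
nRuns neg (neg ∷ ds) = nRuns neg ds
nRuns _   (pos ∷ ds) = nRuns pos ds

N-MNS : ∀ {n} → (Fin n → Dir) → ℕ
N-MNS dir = nRuns pos (toList (tabulate dir))

-- When π = τ every adjacency is matched to itself, so it is positive unless it is a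
-- self-loop ⟨a^t , a^t⟩ (i.e. x_{i+1} = -x_i), which is entangled and inherits the
-- direction of its left neighbour.  Two consecutive self-loops would force
-- x_{i+2} = x_i, impossible because in τ every signed symbol occurs at most once
-- (a gene occurs once; a repeat occurs twice, once with each sign).  So all
-- directions are positive.  Conversely, if no adjacency is negative, each adjacency
-- ⟨r(x_i), l(x_{i+1})⟩ of π equals some ⟨r(y_j), l(y_{j+1})⟩ of τ in this orientation;
-- if x_i = y_i then r(y_j) = r(y_i) forces j = i and hence x_{i+1} = y_{i+1}, and
-- π = τ follows by induction from x_0 = y_0 = +r₀.
module Submission where

open import Defs
open import Data.Nat using (ℕ; zero; suc; _≤_; z≤n; s≤s)
open import Data.Nat.Properties using (suc-injective; ≤-trans; ≤-reflexive; m≢1+n+m)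
open import Data.Fin using (Fin; zero; suc; fromℕ; inject₁; toℕ; punchOut)
open import Data.Fin.Properties
  using (inject₁-injective; toℕ-inject₁; punchOut-injective) renaming (_≟_ to _≟F_)
open import Data.Fin.Induction using (<-weakInduction)
open import Data.Vec using (Vec; _∷_; lookup; tabulate; toList; head; removeAt)
open import Data.Vec.Properties using (tabulate∘lookup; tabulate-cong; removeAt-punchOut)
open import Data.List using ([]; _∷_)
import Data.List as List
open import Data.List.Relation.Unary.All using (All; []; _∷_)
import Data.List.Relation.Unary.All.Properties as All
open import Data.List.Relation.Unary.Any using (Any)
import Data.List.Relation.Unary.Any.Properties as Any
open import Data.List.Relation.Binary.Permutation.Setoid.Properties using (∈-resp-↭)
open import Data.Sum using (inj₁; inj₂)
open import Data.Product using (_×_; _,_; ∃-syntax; proj₁; proj₂)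
open import Data.Product.Properties using (≡-dec)
open import Function using (_∘_)
open import Function.Bundles using (_⇔_; mk⇔; Equivalence)
open import Function.Definitions using (Injective)
open import Relation.Binary.PropositionalEquality
  using (_≡_; _≢_; refl; sym; trans; cong; subst; module ≡-Reasoning)
open import Relation.Binary.Definitions using (DecidableEquality)
open import Relation.Nullary using (yes; no; contradiction)

opposite : Sign → Sign
opposite plus  = minus
opposite minus = plus

opposite-≢ : ∀ sg → opposite sg ≢ sg
opposite-≢ plus  ()
opposite-≢ minus ()

inverse : ∀ {G R} → SSym G R → SSym G R
inverse (sg , a) = (opposite sg , a)

inverse-involutive : ∀ {G R} (x : SSym G R) → inverse (inverse x) ≡ x
inverse-involutive (plus  , a) = refl
inverse-involutive (minus , a) = refl

_≟E_ : DecidableEquality End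
hd ≟E hd = yes refl
hd ≟E tl = no λ ()
tl ≟E hd = no λ ()
tl ≟E tl = yes refl

rnode-injective : ∀ {G R} {x y : SSym G R} → rnode x ≡ rnode y → x ≡ y
rnode-injective {x = plus  , a} {plus  , .a} refl = refl
rnode-injective {x = minus , a} {minus , .a} refl = refl

lnode-injective : ∀ {G R} {x y : SSym G R} → lnode x ≡ lnode y → x ≡ y
lnode-injective {x = plus  , a} {plus  , .a} refl = refl
lnode-injective {x = minus , a} {minus , .a} refl = refl

rnode≡lnode⇒inverse : ∀ {G R} {x y : SSym G R} → rnode x ≡ lnode y → y ≡ inverse x
rnode≡lnode⇒inverse {x = plus  , a} {minus , .a} refl = refl
rnode≡lnode⇒inverse {x = minus , a} {plus  , .a} refl = refl

module _ {S : Set} (_≟_ : DecidableEquality S) where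

  occ-removeAt : ∀ {m s} (v : Vec (Sign × S) (suc m)) i → proj₂ (lookup v i) ≡ s →
                 occ _≟_ s v ≡ suc (occ _≟_ s (removeAt v i))
  occ-removeAt ((_ , b) ∷ v) zero refl with b ≟ b
  ... | yes _   = refl
  ... | no b≢b = contradiction refl b≢b
  occ-removeAt {s = s} ((_ , b) ∷ v@(_ ∷ _)) (suc i) e with s ≟ b
  ... | yes _ = cong suc (occ-removeAt v i e)
  ... | no  _ = occ-removeAt v i e

  occ-positive : ∀ {m s} (v : Vec (Sign × S) m) i → proj₂ (lookup v i) ≡ s → 1 ≤ occ _≟_ s v
  occ-positive {suc _} v i e rewrite occ-removeAt v i e = s≤s z≤n

  occ≤1⇒position-unique : ∀ {m s} (v : Vec (Sign × S) m) → occ _≟_ s v ≤ 1 →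
    ∀ {i j} → proj₂ (lookup v i) ≡ s → proj₂ (lookup v j) ≡ s → i ≡ j
  occ≤1⇒position-unique {suc _} {s} v occ≤1 {i} {j} ei ej with i ≟F j
  ... | yes i≡j = i≡j
  ... | no  i≢j = contradiction (≤-trans two≤occ occ≤1) λ { (s≤s ()) }
    where
    two≤occ : 2 ≤ occ _≟_ s v
    two≤occ rewrite occ-removeAt v i ei =
      s≤s (occ-positive (removeAt v i) (punchOut i≢j) (trans (cong proj₂ (removeAt-punchOut v i≢j)) ej))

  -- Removing the occurrence of the opposite sign leaves a single occurrence of s.
  occ≡2⇒signed-position-unique : ∀ {m s sg c} (v : Vec (Sign × S) (suc m)) →
    occ _≟_ s v ≡ 2 → lookup v c ≡ (opposite sg , s) →
    ∀ {i j} → lookup v i ≡ (sg , s) → lookup v j ≡ (sg , s) → i ≡ j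
  occ≡2⇒signed-position-unique {s = s} {sg} {c} v occ≡2 ec {i} {j} ei ej =
    punchOut-injective c≢i c≢j
      (occ≤1⇒position-unique (removeAt v c) (≤-reflexive occ-rest)
        (symbol-after i c≢i ei) (symbol-after j c≢j ej))
    where
    occ-rest : occ _≟_ s (removeAt v c) ≡ 1
    occ-rest = suc-injective (trans (sym (occ-removeAt v c (cong proj₂ ec))) occ≡2)
    sign-differs : ∀ {k} → lookup v k ≡ (sg , s) → c ≢ k
    sign-differs ek refl = opposite-≢ sg (cong proj₁ (trans (sym ec) ek))
    c≢i = sign-differs ei
    c≢j = sign-differs ej
    symbol-after : ∀ k (c≢k : c ≢ k) → lookup v k ≡ (sg , s) →
                   proj₂ (lookup (removeAt v c) (punchOut c≢k)) ≡ s
    symbol-after k c≢k ek = cong proj₂ (trans (removeAt-punchOut v c≢k) ek)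

lookup-zero : ∀ {A : Set} {m} (v : Vec A (suc m)) → lookup v zero ≡ head v
lookup-zero (x ∷ v) = refl

lookup-extensional : ∀ {A : Set} {m} {u v : Vec A m} → (∀ i → lookup u i ≡ lookup v i) → u ≡ v
lookup-extensional {u = u} {v} u≗v = begin
  u                   ≡⟨ sym (tabulate∘lookup u) ⟩
  tabulate (lookup u) ≡⟨ tabulate-cong u≗v ⟩
  tabulate (lookup v) ≡⟨ tabulate∘lookup v ⟩
  v                   ∎
  where open ≡-Reasoning

toList-tabulate : ∀ {A : Set} {m} (f : Fin m → A) → toList (tabulate f) ≡ List.tabulate f
toList-tabulate {m = zero}  f = refl
toList-tabulate {m = suc m} f = cong (f zero ∷_) (toList-tabulate (f ∘ suc))

nRuns-pos≡0⇔All-pos : ∀ ds → nRuns pos ds ≡ 0 ⇔ All (_≡ pos) ds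
nRuns-pos≡0⇔All-pos ds = mk⇔ (to ds) (from ds)
  where
  to : ∀ ds → nRuns pos ds ≡ 0 → All (_≡ pos) ds
  to []         _  = []
  to (pos ∷ ds) e  = refl ∷ to ds e
  to (neg ∷ ds) ()
  from : ∀ ds → All (_≡ pos) ds → nRuns pos ds ≡ 0
  from []         []          = refl
  from (pos ∷ ds) (_ ∷ all) = from ds all

N-MNS≡0⇔all-pos : ∀ {m} (dir : Fin m → Dir) → N-MNS dir ≡ 0 ⇔ (∀ i → dir i ≡ pos)
N-MNS≡0⇔all-pos dir = mk⇔
  (All.tabulate⁻ ∘ subst (All (_≡ pos)) (toList-tabulate dir) ∘ Equivalence.to runs)
  (Equivalence.from runs ∘ subst (All (_≡ pos)) (sym (toList-tabulate dir)) ∘ All.tabulate⁺)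
  where runs = nRuns-pos≡0⇔All-pos (toList (tabulate dir))

module _ {G R : Set} (_≟G_ : DecidableEquality G) (_≟R_ : DecidableEquality R)
         (r₀ : R) {n : ℕ} where
  open Setting _≟G_ _≟R_ r₀ {n}

  _≟N_ : DecidableEquality (Node G R)
  _≟N_ = ≡-dec _≟S_ _≟E_

  SignedSymbolsOnce : Chr → Set
  SignedSymbolsOnce τ = Injective _≡_ _≡_ (lookup τ)

  twoBalanced⇒signedSymbolsOnce : ∀ {π τ} → TwoBalanced π τ → SignedSymbolsOnce τ
  twoBalanced⇒signedSymbolsOnce {τ = τ}
    (_ , (_ , _ , genes) , _ , _ , _ , _ , _ , repeats , signs) {i} {j} e with lookup τ i in ei
  ... | (_ , inj₁ g) =
    occ≤1⇒position-unique _≟S_ τ (≤-reflexive (genes g)) (cong proj₂ ei) (cong proj₂ (sym e))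
  ... | (sg , inj₂ r) =
    occ≡2⇒signed-position-unique _≟S_ τ (repeats r) (proj₂ (other sg)) ei (sym e)
    where
    other : ∀ sg → ∃[ c ] lookup τ c ≡ (opposite sg , inj₂ r)
    other plus  = proj₂ (signs r)
    other minus = proj₁ (signs r)

  adjacency-matched : ∀ {π τ} → SameAdjacencies π τ → ∀ i → ∃[ j ] adj π i ≈A adj τ j
  adjacency-matched {π} {τ} same i =
    Any.tabulate⁻ (subst (Any _) (toList-tabulate (adj τ))
      (∈-resp-↭ (AdjSetoid G R) same
        (subst (Any _) (sym (toList-tabulate (adj π)))
          (Any.tabulate⁺ {f = adj π} i (inj₁ (refl , refl))))))

  module _ {π τ : Chr} {dir : Fin (suc n) → Dir}
           (valid : ValidDirections _≟G_ _≟R_ r₀ π τ dir) where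

    pos⇒aligned : ∀ {i j} → dir i ≡ pos → adj π i ≈A adj τ j →
                  rA π i ≡ rA τ j × lA π i ≡ lA τ j
    pos⇒aligned _ (inj₁ aligned) = aligned
    pos⇒aligned {i} {j} dir≡pos (inj₂ (r≡l , l≡r)) with rA π i ≟N lA π i
    ... | yes loop = trans loop l≡r , trans (sym loop) r≡l
    ... | no  ¬loop with trans (sym dir≡pos) (proj₁ (proj₂ (valid i)) (j , r≡l , l≡r , ¬loop))
    ...   | ()

    all-pos⇒≡ : SignedSymbolsOnce τ → head π ≡ head τ → SameAdjacencies π τ →
                (∀ i → dir i ≡ pos) → π ≡ τ
    all-pos⇒≡ once heads same all-pos = lookup-extensional (<-weakInduction _ base step)
      where
      base : lookup π zero ≡ lookup τ zero
      base = trans (lookup-zero π) (trans heads (sym (lookup-zero τ)))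
      step : ∀ i → lookup π (inject₁ i) ≡ lookup τ (inject₁ i) →
                   lookup π (suc i) ≡ lookup τ (suc i)
      step i agree with adjacency-matched {π} {τ} same i
      ... | j , match with pos⇒aligned (all-pos i) match
      ...   | r≡r , l≡l
            with inject₁-injective (once (rnode-injective (trans (sym r≡r) (cong rnode agree))))
      ...     | refl = lnode-injective l≡l

  self-matched⇒all-pos : ∀ {π dir} → SignedSymbolsOnce π →
                         ValidDirections _≟G_ _≟R_ r₀ π π dir →
                         dir zero ≡ pos → ∀ i → dir i ≡ pos
  self-matched⇒all-pos {π} {dir} once valid dir₀ = go
    where
    loop-free⇒pos : ∀ i → rA π i ≢ lA π i → dir i ≡ pos
    loop-free⇒pos i ¬loop = proj₁ (valid i) (i , refl , refl , ¬loop)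
    no-consecutive-loops : ∀ i → rA π (inject₁ i) ≡ lA π (inject₁ i) →
                           rA π (suc i) ≢ lA π (suc i)
    no-consecutive-loops i loop₁ loop₂ = m≢1+n+m (toℕ i) {1} (begin
      toℕ i                          ≡⟨ sym (toℕ-inject₁ i) ⟩
      toℕ (inject₁ i)                ≡⟨ sym (toℕ-inject₁ (inject₁ i)) ⟩
      toℕ (inject₁ (inject₁ i))      ≡⟨ cong toℕ (once x₀≡x₂) ⟩
      suc (suc (toℕ i))              ∎)
      where
      open ≡-Reasoning
      x₀≡x₂ : lookup π (inject₁ (inject₁ i)) ≡ lookup π (suc (suc i))
      x₀≡x₂ = sym (trans (rnode≡lnode⇒inverse loop₂)
                (trans (cong inverse (rnode≡lnode⇒inverse loop₁)) (inverse-involutive _)))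
    go : ∀ i → dir i ≡ pos
    go i with rA π i ≟N lA π i
    go i       | no  ¬loop = loop-free⇒pos i ¬loop
    go zero    | yes _     = dir₀
    go (suc i) | yes loop  = trans (sym (loop-copies-left i loop))
                                   (loop-free⇒pos (inject₁ i) (λ loop′ → no-consecutive-loops i loop′ loop))
      where
      loop-copies-left : ∀ i → rA π (suc i) ≡ lA π (suc i) → dir (inject₁ i) ≡ dir (suc i)
      loop-copies-left i loop = proj₂ (proj₂ (valid (suc i))) (suc i , loop , refl , loop)
                                  (inject₁ i) (inj₂ (cong suc (toℕ-inject₁ i)))

theorem5 : {G R : Set} (_≟G_ : DecidableEquality G) (_≟R_ : DecidableEquality R)
    (r₀ : R) (n : ℕ) (π τ : Vec (SSym G R) (suc (suc n))) (dir : Fin (suc n) → Dir) →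
    Setting.TwoBalanced _≟G_ _≟R_ r₀ π τ →
    ValidDirections _≟G_ _≟R_ r₀ π τ dir →
    dir zero ≡ pos →
    dir (fromℕ n) ≡ pos →
    (π ≡ τ) ⇔ (N-MNS dir ≡ 0)
-- The last adjacency need not be assumed positive: an entangled adjacency takes the
-- direction of its left neighbour, so only the first one matters.
theorem5 _≟G_ _≟R_ r₀ n π τ dir
  balanced@((head-π , _) , (head-τ , _) , _ , _ , _ , same , _) valid dir₀ _ = mk⇔ to from
  where
  once : SignedSymbolsOnce _≟G_ _≟R_ r₀ τ
  once = twoBalanced⇒signedSymbolsOnce _≟G_ _≟R_ r₀ {π = π} {τ = τ} balanced
  to : π ≡ τ → N-MNS dir ≡ 0
  to refl = Equivalence.from (N-MNS≡0⇔all-pos dir)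
              (self-matched⇒all-pos _≟G_ _≟R_ r₀ {π = π} once valid dir₀)
  from : N-MNS dir ≡ 0 → π ≡ τ
  from = all-pos⇒≡ _≟G_ _≟R_ r₀ {π = π} {τ = τ} valid once (trans head-π (sym head-τ)) same
       ∘ Equivalence.to (N-MNS≡0⇔all-pos dir)
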